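{- Every rooted tree $T$ contains a stable (independent) set $S_T$ of size $\lceil |V(T)|/6\rceil$ not containing the root such that: (a) every vertex in $S_T$ is either a leaf of $T$, or a vertex of degree $2$ whose parent is also a non-root vertex of degree $2$; and (b) no child of a vertex in $S_T$ is the parent of some other vertex of $S_T$.
   Context: In a rooted tree, the parent of a non-root vertex is its neighbour on the path to the root, and its children are its other neighbours. -}

module Defs where

open import Data.Nat using (ℕ; zero; suc; _+_)
open import Data.Nat.DivMod using (_/_)
open import Data.Fin using (Fin; _≟_)
open import Data.Fin.Subset using (Subset; _∈_; _∉_)
open import Data.List using (length; filter)
open import Data.List.Base using ()
open import Data.Fin.Base using ()
open import Data.Product using (_×_; ∃-syntax)
open import Data.Sum using (_⊎_)
open import Relation.Nullary using (¬_; Dec)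
open import Relation.Nullary.Decidable using (_×-dec_; _⊎-dec_; ¬?)
open import Relation.Binary.PropositionalEquality using (_≡_)
import Data.List as L

iter : {A : Set} → (A → A) → ℕ → A → A
iter f zero    x = x
iter f (suc k) x = f (iter f k x)

-- A rooted tree on the vertex set Fin n, given by its root and a parent
-- function (the value of parent at the root is irrelevant).  The edges are
-- {v , parent v} for v ≢ root.  Every vertex reaches the root by iterating
-- parent; this makes the graph a tree (connected, n - 1 edges), and every
-- rooted tree on n labelled vertices arises this way.
record RootedTree (n : ℕ) : Set where
  field
    root         : Fin n
    parent       : Fin n → Fin n
    reaches-root : ∀ v → ∃[ k ] iter parent k v ≡ root

module _ {n : ℕ} (T : RootedTree n) where
  open RootedTree T

  IsChild : Fin n → Fin n → Set
  IsChild c u = ¬ (c ≡ root) × parent c ≡ u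

  Adj : Fin n → Fin n → Set
  Adj u v = IsChild u v ⊎ IsChild v u

  adj? : (u v : Fin n) → Dec (Adj u v)
  adj? u v = (¬? (u ≟ root) ×-dec (parent u ≟ v)) ⊎-dec (¬? (v ≟ root) ×-dec (parent v ≟ u))

  degree : Fin n → ℕ
  degree u = length (filter (adj? u) (L.allFin n))

  IsLeaf : Fin n → Set
  IsLeaf v = degree v ≡ 1

  Stable : Subset n → Set
  Stable S = ∀ u v → u ∈ S → v ∈ S → ¬ Adj u v

⌈_/6⌉ : ℕ → ℕ
⌈ n /6⌉ = (n + 5) / 6

module Submission where

-- Call a non-root vertex without children a *leaf*, and call v a *link* if
-- v and its parent are non-root vertices with exactly one child each and v
-- has neither a leaf child nor a leaf grandchild.  Leaves and links satisfy
-- condition (a).  A discharging argument (summing the vertex-wise inequality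
-- `local-inequality` over the tree) shows  n ≤ 6·#leaves + #links.  Colour
-- the vertices by depth modulo 3 and let r be the colour held by the most
-- links, so #links ≤ 3·#links-of-colour-r.  The candidates, i.e. the leaves
-- and the links of colour r, are then at least ⌈n/6⌉ many, and no candidate
-- is a child or a grandchild of another: a leaf has no children, a link has
-- no leaf child or grandchild, and links at distance 1 or 2 get different
-- colours.  Any ⌈n/6⌉ candidates form the required set.

open import Defs
open import Data.Bool using (true; false; if_then_else_)
open import Data.Empty using (⊥-elim)
open import Data.Fin using (Fin; zero; suc; _≟_)
open import Data.Fin.Subset using (Subset; _∈_; _∉_; _⊆_; ∣_∣; ⊥)
open import Data.Fin.Subset.Properties using (∉⊥; ∣⊥∣≡0)
open import Data.List using (length; filter; tabulate)
open import Data.Nat using (ℕ; zero; suc; _+_; _*_; _≤_; _<_; z≤n; s≤s)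
open import Data.Nat.DivMod using (_/_; m<n*o⇒m/o<n)
open import Data.Nat.Properties hiding (_≟_)
open import Data.Nat.Properties using () renaming (_≟_ to _≟ℕ_)
open import Data.Nat.Tactic.RingSolver using (solve-∀)
open import Algebra.Properties.Semiring.Sum +-*-semiring
  using (sum; sum-syntax; ∑-distrib-+; ∑-comm; *-distribˡ-sum; sum-cong-≗)
open import Data.Product using (_×_; _,_; proj₁; proj₂; ∃; ∃-syntax)
open import Data.Sum using (_⊎_; inj₁; inj₂)
open import Data.Vec using ([]; _∷_; here; there)
import Data.Vec as Vec
open import Data.Vec.Properties using ([]=⇒lookup; lookup∘tabulate)
open import Function using (_∘_)
open import Level using (Level)
open import Relation.Nullary using (¬_; Dec; yes; no; does; contradiction)
open import Relation.Nullary.Decidable using (_×-dec_; _⊎-dec_; ¬?; decidable-stable)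
open import Relation.Unary using (Pred; Decidable)
open import Relation.Binary.PropositionalEquality

private
  variable
    a b p : Level
    A : Set a
    B : Set b
    m n : ℕ

𝟙 : Dec A → ℕ
𝟙 d = if does d then 1 else 0

𝟙-yes : A → (d : Dec A) → 𝟙 d ≡ 1
𝟙-yes x (yes _) = refl
𝟙-yes x (no ¬x) = ⊥-elim (¬x x)

𝟙-no : ¬ A → (d : Dec A) → 𝟙 d ≡ 0
𝟙-no ¬x (yes x) = ⊥-elim (¬x x)
𝟙-no ¬x (no _)  = refl

𝟙≤1 : (d : Dec A) → 𝟙 d ≤ 1
𝟙≤1 (yes _) = ≤-refl
𝟙≤1 (no _)  = z≤n

𝟙-× : (x : Dec A) (y : Dec B) → 𝟙 (x ×-dec y) ≡ 𝟙 x * 𝟙 y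
𝟙-× (yes _) (yes _) = refl
𝟙-× (yes _) (no _)  = refl
𝟙-× (no _)  _       = refl

𝟙-⊎ : ¬ (A × B) → (x : Dec A) (y : Dec B) → 𝟙 (x ⊎-dec y) ≡ 𝟙 x + 𝟙 y
𝟙-⊎ disjoint (yes x) (yes y) = ⊥-elim (disjoint (x , y))
𝟙-⊎ disjoint (yes _) (no _)  = refl
𝟙-⊎ disjoint (no _)  (yes _) = refl
𝟙-⊎ disjoint (no _)  (no _)  = refl

𝟙-¬ : (x : Dec A) → 𝟙 (¬? x) + 𝟙 x ≡ 1
𝟙-¬ (yes _) = refl
𝟙-¬ (no _)  = refl

𝟙-cong : (A → B) → (B → A) → (x : Dec A) (y : Dec B) → 𝟙 x ≡ 𝟙 y
𝟙-cong A→B B→A (yes x) y = sym (𝟙-yes (A→B x) y)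
𝟙-cong A→B B→A (no ¬x) y = sym (𝟙-no (¬x ∘ B→A) y)

∑-mono : {f g : Fin n → ℕ} → (∀ i → f i ≤ g i) → sum f ≤ sum g
∑-mono {zero}  f≤g = z≤n
∑-mono {suc n} f≤g = +-mono-≤ (f≤g zero) (∑-mono (f≤g ∘ suc))

∑-const : ∀ n k → ∑[ i < n ] k ≡ n * k
∑-const zero    k = refl
∑-const (suc n) k = cong (k +_) (∑-const n k)

∑-term : (f : Fin n → ℕ) (i : Fin n) → f i ≤ sum f
∑-term f zero    = m≤m+n (f zero) _
∑-term f (suc i) = m≤n⇒m≤o+n (f zero) (∑-term (f ∘ suc) i)

∑-*ˡ : ∀ {n} k (f : Fin n → ℕ) → ∑[ i < n ] (k * f i) ≡ k * sum f
∑-*ˡ k f = sym (*-distribˡ-sum k f)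

∑-δ : (i : Fin n) (h : Fin n → ℕ) → ∑[ j < n ] (𝟙 (i ≟ j) * h j) ≡ h i
∑-δ {suc n} zero    h = trans (cong₂ _+_ (+-identityʳ (h zero)) (trans (∑-const n 0) (*-zeroʳ n)))
                              (+-identityʳ (h zero))
∑-δ {suc n} (suc i) h = ∑-δ i (h ∘ suc)

∑-δ-count : (i : Fin n) → ∑[ j < n ] 𝟙 (i ≟ j) ≡ 1
∑-δ-count i = trans (sum-cong-≗ (λ j → sym (*-identityʳ (𝟙 (i ≟ j))))) (∑-δ i (λ _ → 1))

argmax : (f : Fin (suc m) → ℕ) → ∃[ r ] (∀ i → f i ≤ f r)
argmax {zero}  f = zero , λ { zero → ≤-refl }
argmax {suc m} f with argmax (f ∘ suc)
... | r , max with ≤-total (f zero) (f (suc r))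
...   | inj₁ f₀≤ = suc r , λ { zero → f₀≤ ; (suc i) → max i }
...   | inj₂ ≤f₀ = zero , λ { zero → ≤-refl ; (suc i) → ≤-trans (max i) ≤f₀ }

∑-≤-max : (f : Fin (suc m) → ℕ) → ∃[ r ] sum f ≤ suc m * f r
∑-≤-max {m} f with argmax f
... | r , max = r , ≤-trans (∑-mono max) (≤-reflexive (∑-const (suc m) (f r)))

fibreSum : (Fin n → ℕ) → (Fin n → Fin m) → Fin m → ℕ
fibreSum g f v = sum (λ c → g c * 𝟙 (f c ≟ v))

∑-fibres : ∀ {m n} (g : Fin n → ℕ) (f : Fin n → Fin m) (h : Fin m → ℕ) →
           ∑[ v < m ] (h v * fibreSum g f v) ≡ ∑[ c < n ] (g c * h (f c))
∑-fibres {m} {n} g f h = begin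
    ∑[ v < m ] (h v * ∑[ c < n ] (g c * 𝟙 (f c ≟ v)))
  ≡⟨ sum-cong-≗ {m} (λ v → sym (∑-*ˡ (h v) (λ c → g c * 𝟙 (f c ≟ v)))) ⟩
    ∑[ v < m ] ∑[ c < n ] (h v * (g c * 𝟙 (f c ≟ v)))
  ≡⟨ ∑-comm {m} {n} _ ⟩
    ∑[ c < n ] ∑[ v < m ] (h v * (g c * 𝟙 (f c ≟ v)))
  ≡⟨ sum-cong-≗ {n} (λ c → sum-cong-≗ {m} (λ v → rearrange (h v) (g c) (𝟙 (f c ≟ v)))) ⟩
    ∑[ c < n ] ∑[ v < m ] (g c * (𝟙 (f c ≟ v) * h v))
  ≡⟨ sum-cong-≗ {n} (λ c → trans (∑-*ˡ (g c) (λ v → 𝟙 (f c ≟ v) * h v))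
                                  (cong (g c *_) (∑-δ {m} (f c) h))) ⟩
    ∑[ c < n ] (g c * h (f c))
  ∎
  where
  open ≡-Reasoning
  rearrange : ∀ x y z → x * (y * z) ≡ y * (z * x)
  rearrange = solve-∀

∑-fibres-total : ∀ {m n} (g : Fin n → ℕ) (f : Fin n → Fin m) → ∑[ v < m ] fibreSum g f v ≡ sum g
∑-fibres-total {m} {n} g f =
  trans (sum-cong-≗ {m} (λ v → sym (*-identityˡ (fibreSum g f v))))
        (trans (∑-fibres g f (λ _ → 1)) (sum-cong-≗ {n} (λ c → *-identityʳ (g c))))

fibreSum-member : {P : Pred (Fin n) p} (P? : Decidable P) (f : Fin n → Fin m) {c : Fin n} {v : Fin m} →
                  P c → f c ≡ v → 1 ≤ fibreSum (λ c → 𝟙 (P? c)) f v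
fibreSum-member P? f {c} {v} Pc fc≡v =
  ≤-trans (≤-reflexive (sym (cong₂ _*_ (𝟙-yes Pc (P? c)) (𝟙-yes fc≡v (f c ≟ v)))))
          (∑-term (λ c → 𝟙 (P? c) * 𝟙 (f c ≟ v)) c)

length-filter-tabulate : {P : Pred A p} (P? : Decidable P) (f : Fin n → A) →
                         length (filter P? (tabulate f)) ≡ ∑[ i < n ] 𝟙 (P? (f i))
length-filter-tabulate {n = zero}  P? f = refl
length-filter-tabulate {n = suc n} P? f with P? (f zero)
... | yes _ = cong suc (length-filter-tabulate P? (f ∘ suc))
... | no _  = length-filter-tabulate P? (f ∘ suc)

⟦_⟧ : {P : Pred (Fin n) p} → Decidable P → Subset n
⟦ P? ⟧ = Vec.tabulate (λ v → does (P? v))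

∣⟦⟧∣ : {P : Pred (Fin n) p} (P? : Decidable P) → ∣ ⟦ P? ⟧ ∣ ≡ ∑[ v < n ] 𝟙 (P? v)
∣⟦⟧∣ {n = zero}  P? = refl
∣⟦⟧∣ {n = suc n} P? with P? zero
... | yes _ = cong suc (∣⟦⟧∣ (P? ∘ suc))
... | no _  = ∣⟦⟧∣ (P? ∘ suc)

∈⟦⟧ : {P : Pred (Fin n) p} (P? : Decidable P) {v : Fin n} → v ∈ ⟦ P? ⟧ → P v
∈⟦⟧ P? {v} v∈ with P? v | trans (sym (lookup∘tabulate (λ i → does (P? i)) v)) ([]=⇒lookup v∈)
... | yes Pv | _  = Pv
... | no _   | ()

shrink : ∀ {n} (q : Subset n) (k : ℕ) → k ≤ ∣ q ∣ → ∃[ s ] (s ⊆ q × ∣ s ∣ ≡ k)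
shrink []          zero    _ = [] , (λ x → x) , refl
shrink (false ∷ q) k       k≤ with shrink q k k≤
... | s , s⊆q , ∣s∣ = false ∷ s , (λ { (there x) → there (s⊆q x) }) , ∣s∣
shrink {suc n} (true ∷ q) zero _ = ⊥ , (λ x → ⊥-elim (∉⊥ x)) , ∣⊥∣≡0 (suc n)
shrink (true ∷ q)  (suc k) (s≤s k≤) with shrink q k k≤
... | s , s⊆q , ∣s∣ = true ∷ s , (λ { here → here ; (there x) → there (s⊆q x) }) , cong suc ∣s∣

⌈/6⌉-≤ : ∀ n s → n ≤ 6 * s → ⌈ n /6⌉ ≤ s
⌈/6⌉-≤ n s n≤6s = ≤-pred (m<n*o⇒m/o<n {n + 5} {suc s} {6} (begin-strict
    n + 5      <⟨ ≤-reflexive (shift n) ⟩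
    n + 6      ≤⟨ +-monoˡ-≤ 6 n≤6s ⟩
    6 * s + 6  ≡⟨ reorder s ⟩
    suc s * 6  ∎))
  where
  open ≤-Reasoning
  shift : ∀ n → suc (n + 5) ≡ n + 6
  shift = solve-∀
  reorder : ∀ s → 6 * s + 6 ≡ suc s * 6
  reorder = solve-∀

-- The arithmetic closing the discharging argument (s + 1 = n, l leaves,
-- d links, P the charge moved from branching vertices to their children).
discharging-arith : ∀ s P l d → suc s * 4 + P ≤ 3 * s + (4 * l + 3 + (d + l + l + P)) → suc s ≤ 6 * l + d
discharging-arith s P l d ≤ = +-cancelˡ-≤ (3 * s + 3 + P) _ _ (subst₂ _≤_ (lhs s P) (rhs s P l d) ≤)
  where
  lhs : ∀ s P → suc s * 4 + P ≡ 3 * s + 3 + P + suc s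
  lhs = solve-∀
  rhs : ∀ s P l d → 3 * s + (4 * l + 3 + (d + l + l + P)) ≡ 3 * s + 3 + P + (6 * l + d)
  rhs = solve-∀

Least : (ℕ → Set p) → ℕ → Set p
Least P k = P k × (∀ {j} → j < k → ¬ P j)

least-unique : {P : ℕ → Set p} {k l : ℕ} → Least P k → Least P l → k ≡ l
least-unique (Pk , below-k) (Pl , below-l) =
  ≤-antisym (≮⇒≥ (λ l<k → below-k l<k Pl)) (≮⇒≥ (λ k<l → below-l k<l Pk))

module _ {P : ℕ → Set p} (P? : Decidable P) where

  scan : ∀ k → (∃[ j ] (j < k × Least P j)) ⊎ (∀ {j} → j < k → ¬ P j)
  scan zero = inj₂ (λ ())
  scan (suc k) with scan k
  ... | inj₁ (j , j<k , least-j) = inj₁ (j , m<n⇒m<1+n j<k , least-j)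
  ... | inj₂ none with P? k
  ...   | yes Pk = inj₁ (k , n<1+n k , Pk , none)
  ...   | no ¬Pk = inj₂ below
    where
    below : ∀ {j} → j < suc k → ¬ P j
    below (s≤s j≤k) with m≤n⇒m<n∨m≡n j≤k
    ... | inj₁ j<k  = none j<k
    ... | inj₂ refl = ¬Pk

  least : ∃ P → ∃ (Least P)
  least (k , Pk) with scan (suc k)
  ... | inj₁ (j , _ , least-j) = j , least-j
  ... | inj₂ none              = ⊥-elim (none (n<1+n k) Pk)

iter-shift : (f : A → A) (k : ℕ) (x : A) → iter f (suc k) x ≡ iter f k (f x)
iter-shift f zero    x = refl
iter-shift f (suc k) x = cong f (iter-shift f k x)

-- Colours are elements of Fin 3; a child gets the colour after its parent's,
-- so vertices at distance 1 or 2 along a root path get different colours.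
next : Fin 3 → Fin 3
next zero             = suc zero
next (suc zero)       = suc (suc zero)
next (suc (suc zero)) = zero

next-≢ : ∀ x → ¬ next x ≡ x
next-≢ zero             ()
next-≢ (suc zero)       ()
next-≢ (suc (suc zero)) ()

next²-≢ : ∀ x → ¬ next (next x) ≡ x
next²-≢ zero             ()
next²-≢ (suc zero)       ()
next²-≢ (suc (suc zero)) ()

mod3 : ℕ → Fin 3
mod3 zero    = zero
mod3 (suc k) = next (mod3 k)

module TreeStructure {n : ℕ} (T : RootedTree n) where
  open RootedTree T

  nonRoot? : Decidable (λ v → ¬ v ≡ root)
  nonRoot? v = ¬? (v ≟ root)

  HitsRoot : Fin n → ℕ → Set
  HitsRoot v k = iter parent k v ≡ root

  depth-least : ∀ v → ∃ (Least (HitsRoot v))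
  depth-least v = least (λ k → iter parent k v ≟ root) (reaches-root v)

  depth : Fin n → ℕ
  depth v = proj₁ (depth-least v)

  depth-child : ∀ c → ¬ c ≡ root → depth c ≡ suc (depth (parent c))
  depth-child c c≢r = least-unique (proj₂ (depth-least c)) (hits , below)
    where
    d : ℕ
    d = depth (parent c)
    least-d : Least (HitsRoot (parent c)) d
    least-d = proj₂ (depth-least (parent c))
    hits : HitsRoot c (suc d)
    hits = trans (iter-shift parent d c) (proj₁ least-d)
    below : ∀ {j} → j < suc d → ¬ HitsRoot c j
    below {zero}  _         = c≢r
    below {suc j} (s≤s j<d) = proj₂ least-d j<d ∘ trans (sym (iter-shift parent j c))

  colour : Fin n → Fin 3
  colour v = mod3 (depth v)

  colour-child : ∀ c → ¬ c ≡ root → colour c ≡ next (colour (parent c))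
  colour-child c c≢r = cong mod3 (depth-child c c≢r)

  -- Two non-root vertices are never each other's parent (depths differ by 2).
  no-2-cycle : ∀ {u v} → ¬ u ≡ root → ¬ v ≡ root → parent u ≡ v → ¬ parent v ≡ u
  no-2-cycle {u} {v} u≢r v≢r pu≡v pv≡u = <⇒≢ (m<n⇒m<1+n (n<1+n (depth u))) two-steps
    where
    open ≡-Reasoning
    two-steps : depth u ≡ suc (suc (depth u))
    two-steps = begin
      depth u                       ≡⟨ depth-child u u≢r ⟩
      suc (depth (parent u))        ≡⟨ cong (λ x → suc (depth x)) pu≡v ⟩
      suc (depth v)                 ≡⟨ cong suc (depth-child v v≢r) ⟩
      suc (suc (depth (parent v)))  ≡⟨ cong (λ x → suc (suc (depth x))) pv≡u ⟩
      suc (suc (depth u))           ∎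

  children : Fin n → ℕ
  children = fibreSum (λ c → 𝟙 (nonRoot? c)) parent

  child-counted : ∀ {c v} → IsChild T c v → 1 ≤ children v
  child-counted (c≢r , pc≡v) = fibreSum-member nonRoot? parent c≢r pc≡v

  -- The vertex reached one step before the root is a child of the root.
  root-has-child : 2 ≤ n → 1 ≤ children root
  root-has-child 2≤n = last-step (proj₂ (other-vertex 2≤n root)) (proj₂ (depth-least v))
    where
    other-vertex : ∀ {m} → 2 ≤ m → (r : Fin m) → ∃[ v ] ¬ v ≡ r
    other-vertex (s≤s (s≤s _)) zero    = suc zero , λ ()
    other-vertex (s≤s (s≤s _)) (suc r) = zero , λ ()
    v : Fin n
    v = proj₁ (other-vertex 2≤n root)
    last-step : ∀ {k} → ¬ v ≡ root → Least (HitsRoot v) k → 1 ≤ children root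
    last-step {zero}  v≢r (hit , _)     = ⊥-elim (v≢r hit)
    last-step {suc k} v≢r (hit , below) = child-counted (below (n<1+n k) , hit)

  degree-formula : ∀ v → degree T v ≡ 𝟙 (nonRoot? v) + children v
  degree-formula v = begin
      degree T v
    ≡⟨ length-filter-tabulate (adj? T v) (λ u → u) ⟩
      ∑[ u < n ] 𝟙 (adj? T v u)
    ≡⟨ sum-cong-≗ {n} adjacency ⟩
      ∑[ u < n ] (𝟙 (nonRoot? v) * 𝟙 (parent v ≟ u) + 𝟙 (nonRoot? u) * 𝟙 (parent u ≟ v))
    ≡⟨ ∑-distrib-+ {n} (λ u → 𝟙 (nonRoot? v) * 𝟙 (parent v ≟ u))
                       (λ u → 𝟙 (nonRoot? u) * 𝟙 (parent u ≟ v)) ⟩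
      ∑[ u < n ] (𝟙 (nonRoot? v) * 𝟙 (parent v ≟ u)) + children v
    ≡⟨ cong (_+ children v) parent-counted-once ⟩
      𝟙 (nonRoot? v) + children v
    ∎
    where
    open ≡-Reasoning
    adjacency : ∀ u → 𝟙 (adj? T v u)
                      ≡ 𝟙 (nonRoot? v) * 𝟙 (parent v ≟ u) + 𝟙 (nonRoot? u) * 𝟙 (parent u ≟ v)
    adjacency u = trans (𝟙-⊎ (λ ((v≢r , pv≡u) , (u≢r , pu≡v)) → no-2-cycle u≢r v≢r pu≡v pv≡u)
                              (nonRoot? v ×-dec (parent v ≟ u)) (nonRoot? u ×-dec (parent u ≟ v)))
                        (cong₂ _+_ (𝟙-× (nonRoot? v) (parent v ≟ u)) (𝟙-× (nonRoot? u) (parent u ≟ v)))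
    parent-counted-once : ∑[ u < n ] (𝟙 (nonRoot? v) * 𝟙 (parent v ≟ u)) ≡ 𝟙 (nonRoot? v)
    parent-counted-once = trans (∑-*ˡ (𝟙 (nonRoot? v)) (λ u → 𝟙 (parent v ≟ u)))
                                (trans (cong (𝟙 (nonRoot? v) *_) (∑-δ-count (parent v))) (*-identityʳ _))

  root-count : ∑[ v < n ] 𝟙 (v ≟ root) ≡ 1
  root-count = trans (sum-cong-≗ {n} (λ v → 𝟙-cong sym sym (v ≟ root) (root ≟ v))) (∑-δ-count root)

  -- Exactly one vertex is the root, so n - 1 vertices are non-root.
  #nonRoot : ℕ
  #nonRoot = ∑[ v < n ] 𝟙 (nonRoot? v)

  nonRoot-count : suc #nonRoot ≡ n
  nonRoot-count = begin
      suc #nonRoot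
    ≡⟨ +-comm 1 #nonRoot ⟩
      #nonRoot + 1
    ≡⟨ cong (#nonRoot +_) root-count ⟨
      #nonRoot + ∑[ v < n ] 𝟙 (v ≟ root)
    ≡⟨ ∑-distrib-+ {n} (λ v → 𝟙 (nonRoot? v)) (λ v → 𝟙 (v ≟ root)) ⟨
      ∑[ v < n ] (𝟙 (nonRoot? v) + 𝟙 (v ≟ root))
    ≡⟨ sum-cong-≗ {n} (λ v → 𝟙-¬ (v ≟ root)) ⟩
      ∑[ v < n ] 1
    ≡⟨ trans (∑-const n 1) (*-identityʳ n) ⟩
      n
    ∎
    where open ≡-Reasoning

  -- Every non-root vertex is the child of exactly one vertex.
  children-total : sum children ≡ #nonRoot
  children-total = ∑-fibres-total (λ c → 𝟙 (nonRoot? c)) parent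

module Discharging {n : ℕ} (T : RootedTree n) where
  open RootedTree T
  open TreeStructure T

  Leaf : Fin n → Set
  Leaf v = ¬ v ≡ root × children v ≡ 0

  leaf? : Decidable Leaf
  leaf? v = nonRoot? v ×-dec (children v ≟ℕ 0)

  leafChildren leafGrandchildren : Fin n → ℕ
  leafChildren      = fibreSum (λ c → 𝟙 (leaf? c)) parent
  leafGrandchildren = fibreSum (λ c → 𝟙 (leaf? c)) (parent ∘ parent)

  Link : Fin n → Set
  Link v = ¬ v ≡ root × children v ≡ 1 × ¬ parent v ≡ root × children (parent v) ≡ 1
           × leafChildren v ≡ 0 × leafGrandchildren v ≡ 0

  link? : Decidable Link
  link? v = nonRoot? v ×-dec (children v ≟ℕ 1) ×-dec nonRoot? (parent v) ×-dec (children (parent v) ≟ℕ 1)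
            ×-dec (leafChildren v ≟ℕ 0) ×-dec (leafGrandchildren v ≟ℕ 0)

  leaf-shape : ∀ {v} → Leaf v → IsLeaf T v
  leaf-shape {v} (v≢r , childless) = trans (degree-formula v) (cong₂ _+_ (𝟙-yes v≢r (nonRoot? v)) childless)

  link-shape : ∀ {v} → Link v → degree T v ≡ 2 × ¬ parent v ≡ root × degree T (parent v) ≡ 2
  link-shape {v} (v≢r , one , p≢r , p-one , _) =
    trans (degree-formula v) (cong₂ _+_ (𝟙-yes v≢r (nonRoot? v)) one) , p≢r ,
    trans (degree-formula (parent v)) (cong₂ _+_ (𝟙-yes p≢r (nonRoot? (parent v))) p-one)

  Branching : Fin n → Set
  Branching v = v ≡ root ⊎ ¬ children v ≡ 1

  branching? : Decidable Branching
  branching? v = (v ≟ root) ⊎-dec ¬? (children v ≟ℕ 1)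

  -- Discharging: a branching vertex sends one unit of charge to each child.
  sent received : Fin n → ℕ
  sent v     = 𝟙 (branching? v) * children v
  received v = 𝟙 (nonRoot? v) * 𝟙 (branching? (parent v))

  sent≤children : ∀ v → sent v ≤ children v
  sent≤children v = ≤-trans (*-monoˡ-≤ (children v) (𝟙≤1 (branching? v))) (≤-reflexive (+-identityʳ _))

  -- The charge a vertex can rely on besides its children: one unit if it is
  -- a link, one per leaf child and per leaf grandchild, and what it receives.
  support : Fin n → ℕ
  support v = 𝟙 (link? v) + leafChildren v + leafGrandchildren v + received v

  -- Its total extra charge: 4 for a leaf, 3 for the root, and the support.
  -- The total weight is 6·#leaves + #links + 3 + (total received charge).
  weight : Fin n → ℕ
  weight v = 4 * 𝟙 (leaf? v) + 3 * 𝟙 (v ≟ root) + support v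

  -- A non-root vertex with one child is a link, or has a leaf child or
  -- grandchild, or has a branching parent.
  support-pos : ∀ v → ¬ v ≡ root → children v ≡ 1 → 1 ≤ support v
  support-pos v v≢r one
    with link? v | branching? (parent v) | leafChildren v ≟ℕ 0 | leafGrandchildren v ≟ℕ 0
  ... | yes link | _ | _ | _ =
    m≤n⇒m≤n+o (received v) (m≤n⇒m≤n+o (leafGrandchildren v) (m≤n⇒m≤n+o (leafChildren v)
      (≤-reflexive (sym (𝟙-yes link (link? v))))))
  ... | no _ | yes b | _ | _ =
    m≤n⇒m≤o+n (𝟙 (link? v) + leafChildren v + leafGrandchildren v)
      (≤-reflexive (sym (cong₂ _*_ (𝟙-yes v≢r (nonRoot? v)) (𝟙-yes b (branching? (parent v))))))
  ... | no _ | no _ | no lc≢0 | _ =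
    m≤n⇒m≤n+o (received v) (m≤n⇒m≤n+o (leafGrandchildren v) (m≤n⇒m≤o+n (𝟙 (link? v)) (n≢0⇒n>0 lc≢0)))
  ... | no _ | no _ | yes _ | no gc≢0 =
    m≤n⇒m≤n+o (received v) (m≤n⇒m≤o+n (𝟙 (link? v) + leafChildren v) (n≢0⇒n>0 gc≢0))
  ... | no ¬link | no ¬b | yes lc≡0 | yes gc≡0 =
    ⊥-elim (¬link (v≢r , one , ¬b ∘ inj₁ , decidable-stable (children (parent v) ≟ℕ 1) (¬b ∘ inj₂)
                  , lc≡0 , gc≡0))

  -- The vertex-wise inequality 4 + sent v ≤ 3·children v + weight v, i.e.
  -- after discharging every vertex keeps charge at least 4; summed over the
  -- tree it reads 4n ≤ 3(n - 1) + 6·#leaves + #links + 3.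
  root-inequality : 1 ≤ children root → 4 + sent root ≤ 3 * children root + weight root
  root-inequality root-child =
    arith (sent root) (children root) (weight root) (sent≤children root) root-child root-weight
    where
    root-weight : 3 ≤ weight root
    root-weight = m≤n⇒m≤n+o (support root) (m≤n⇒m≤o+n (4 * 𝟙 (leaf? root))
                    (≤-reflexive (sym (cong (3 *_) (𝟙-yes refl (root ≟ root))))))
    arith : ∀ s c x → s ≤ c → 1 ≤ c → 3 ≤ x → 4 + s ≤ 3 * c + x
    arith s (suc c) x s≤c _ 3≤x = begin
      4 + s                       ≤⟨ +-monoʳ-≤ 4 s≤c ⟩
      4 + suc c                   ≤⟨ m≤m+n (4 + suc c) (suc (c + c)) ⟩
      4 + suc c + suc (c + c)     ≡⟨ rearrange c ⟩
      3 * suc c + 3               ≤⟨ +-monoʳ-≤ (3 * suc c) 3≤x ⟩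
      3 * suc c + x               ∎
      where
      open ≤-Reasoning
      rearrange : ∀ c → 4 + suc c + suc (c + c) ≡ 3 * suc c + 3
      rearrange = solve-∀

  nonRoot-inequality : ∀ v → ¬ v ≡ root → ∀ k → children v ≡ k → 4 + sent v ≤ 3 * k + weight v
  nonRoot-inequality v v≢r zero count = begin
      4 + sent v                  ≤⟨ +-monoʳ-≤ 4 (≤-trans (sent≤children v) (≤-reflexive count)) ⟩
      4 * 1                       ≡⟨ cong (4 *_) (𝟙-yes (v≢r , count) (leaf? v)) ⟨
      4 * 𝟙 (leaf? v)             ≤⟨ m≤n⇒m≤n+o (support v) (m≤m+n _ (3 * 𝟙 (v ≟ root))) ⟩
      weight v                    ∎
    where open ≤-Reasoning
  nonRoot-inequality v v≢r (suc zero) count = begin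
      4 + sent v                  ≡⟨ cong (λ b → 4 + b * children v) (𝟙-no not-branching (branching? v)) ⟩
      3 + 1                       ≤⟨ +-monoʳ-≤ 3 weight-pos ⟩
      3 + weight v                ∎
    where
    open ≤-Reasoning
    weight-pos : 1 ≤ weight v
    weight-pos = m≤n⇒m≤o+n (4 * 𝟙 (leaf? v) + 3 * 𝟙 (v ≟ root)) (support-pos v v≢r count)
    not-branching : ¬ Branching v
    not-branching (inj₁ v≡r)  = v≢r v≡r
    not-branching (inj₂ ¬one) = ¬one count
  nonRoot-inequality v v≢r (suc (suc k)) count = begin
      4 + sent v                  ≤⟨ +-monoʳ-≤ 4 (≤-trans (sent≤children v) (≤-reflexive count)) ⟩
      4 + suc (suc k)             ≤⟨ m≤m+n _ (k + k) ⟩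
      4 + suc (suc k) + (k + k)   ≡⟨ rearrange k ⟩
      3 * suc (suc k)             ≤⟨ m≤m+n _ (weight v) ⟩
      3 * suc (suc k) + weight v  ∎
    where
    open ≤-Reasoning
    rearrange : ∀ k → 4 + suc (suc k) + (k + k) ≡ 3 * suc (suc k)
    rearrange = solve-∀

  local-inequality : 1 ≤ children root → ∀ v → 4 + sent v ≤ 3 * children v + weight v
  local-inequality root-child v = by-cases (v ≟ root)
    where
    by-cases : Dec (v ≡ root) → 4 + sent v ≤ 3 * children v + weight v
    by-cases (yes v≡r) = subst (λ u → 4 + sent u ≤ 3 * children u + weight u) (sym v≡r)
                               (root-inequality root-child)
    by-cases (no v≢r)  = nonRoot-inequality v v≢r (children v) refl

  #leaves #links : ℕ
  #leaves = ∑[ v < n ] 𝟙 (leaf? v)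
  #links  = ∑[ v < n ] 𝟙 (link? v)

  -- Each child of a branching vertex is counted once as sent, once as received.
  sent-received : sum sent ≡ sum received
  sent-received = ∑-fibres (λ c → 𝟙 (nonRoot? c)) parent (λ v → 𝟙 (branching? v))

  -- Each leaf is counted once as a leaf child and once as a leaf grandchild.
  support-total : sum support ≡ #links + #leaves + #leaves + sum received
  support-total =
    trans (∑-distrib-+ {n} (λ v → 𝟙 (link? v) + leafChildren v + leafGrandchildren v) received)
      (cong (_+ sum received)
        (trans (∑-distrib-+ {n} (λ v → 𝟙 (link? v) + leafChildren v) leafGrandchildren)
          (cong₂ _+_
            (trans (∑-distrib-+ {n} (λ v → 𝟙 (link? v)) leafChildren)
                   (cong (#links +_) (∑-fibres-total (λ c → 𝟙 (leaf? c)) parent)))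
            (∑-fibres-total (λ c → 𝟙 (leaf? c)) (parent ∘ parent)))))

  weight-total : sum weight ≡ 4 * #leaves + 3 + (#links + #leaves + #leaves + sum received)
  weight-total =
    trans (∑-distrib-+ {n} (λ v → 4 * 𝟙 (leaf? v) + 3 * 𝟙 (v ≟ root)) support)
      (cong₂ _+_
        (trans (∑-distrib-+ {n} (λ v → 4 * 𝟙 (leaf? v)) (λ v → 3 * 𝟙 (v ≟ root)))
               (cong₂ _+_ (∑-*ˡ 4 (λ v → 𝟙 (leaf? v)))
                          (trans (∑-*ˡ 3 (λ v → 𝟙 (v ≟ root))) (cong (3 *_) root-count))))
        support-total)

  discharging : 2 ≤ n → n ≤ 6 * #leaves + #links
  discharging 2≤n = subst (_≤ 6 * #leaves + #links) nonRoot-count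
    (discharging-arith #nonRoot (sum received) #leaves #links (subst₂ _≤_ total-sent total-kept summed))
    where
    summed : ∑[ v < n ] (4 + sent v) ≤ ∑[ v < n ] (3 * children v + weight v)
    summed = ∑-mono (local-inequality (root-has-child 2≤n))
    total-sent : ∑[ v < n ] (4 + sent v) ≡ suc #nonRoot * 4 + sum received
    total-sent = trans (∑-distrib-+ {n} (λ _ → 4) sent)
                       (cong₂ _+_ (trans (∑-const n 4) (cong (_* 4) (sym nonRoot-count))) sent-received)
    total-kept : ∑[ v < n ] (3 * children v + weight v)
                 ≡ 3 * #nonRoot + (4 * #leaves + 3 + (#links + #leaves + #leaves + sum received))
    total-kept = trans (∑-distrib-+ {n} (λ v → 3 * children v) weight)
                       (cong₂ _+_ (trans (∑-*ˡ 3 children) (cong (3 *_) children-total)) weight-total)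

module Candidates {n : ℕ} (T : RootedTree n) where
  open RootedTree T
  open TreeStructure T
  open Discharging T

  linksOfColour : Fin 3 → ℕ
  linksOfColour = fibreSum (λ v → 𝟙 (link? v)) colour

  popular-colour : ∃[ r ] #links ≤ 3 * linksOfColour r
  popular-colour with ∑-≤-max linksOfColour
  ... | r , ≤max = r , subst (_≤ 3 * linksOfColour r) (∑-fibres-total (λ v → 𝟙 (link? v)) colour) ≤max

  Candidate : Fin 3 → Fin n → Set
  Candidate r v = Leaf v ⊎ (Link v × colour v ≡ r)

  candidate? : ∀ r → Decidable (Candidate r)
  candidate? r v = leaf? v ⊎-dec (link? v ×-dec (colour v ≟ r))

  -- Leaves and links are disjoint (no children versus one child).
  candidate-count : ∀ r → ∑[ v < n ] 𝟙 (candidate? r v) ≡ #leaves + linksOfColour r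
  candidate-count r = trans (sum-cong-≗ {n} split)
                            (∑-distrib-+ {n} (λ v → 𝟙 (leaf? v)) (λ v → 𝟙 (link? v) * 𝟙 (colour v ≟ r)))
    where
    leaf-not-link : ∀ {v} → ¬ (Leaf v × (Link v × colour v ≡ r))
    leaf-not-link ((_ , none) , ((_ , one , _) , _)) = 0≢1+n (trans (sym none) one)
    split : ∀ v → 𝟙 (candidate? r v) ≡ 𝟙 (leaf? v) + 𝟙 (link? v) * 𝟙 (colour v ≟ r)
    split v = trans (𝟙-⊎ leaf-not-link (leaf? v) (link? v ×-dec (colour v ≟ r)))
                    (cong (𝟙 (leaf? v) +_) (𝟙-× (link? v) (colour v ≟ r)))

  enough-candidates : 2 ≤ n → ∃[ r ] ⌈ n /6⌉ ≤ ∑[ v < n ] 𝟙 (candidate? r v)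
  enough-candidates 2≤n with popular-colour
  ... | r , few = r , ⌈/6⌉-≤ n _ (begin
      n                                    ≤⟨ discharging 2≤n ⟩
      6 * #leaves + #links                 ≤⟨ +-monoʳ-≤ (6 * #leaves) few ⟩
      6 * #leaves + 3 * linksOfColour r    ≤⟨ +-monoʳ-≤ (6 * #leaves) (*-monoˡ-≤ (linksOfColour r) (m≤m+n 3 3)) ⟩
      6 * #leaves + 6 * linksOfColour r    ≡⟨ *-distribˡ-+ 6 #leaves (linksOfColour r) ⟨
      6 * (#leaves + linksOfColour r)      ≡⟨ cong (6 *_) (candidate-count r) ⟨
      6 * ∑[ v < n ] 𝟙 (candidate? r v)    ∎)
    where open ≤-Reasoning

  candidate-nonRoot : ∀ {r v} → Candidate r v → ¬ v ≡ root
  candidate-nonRoot (inj₁ (v≢r , _))       = v≢r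
  candidate-nonRoot (inj₂ ((v≢r , _) , _)) = v≢r

  candidate-shape : ∀ {r v} → Candidate r v →
                    IsLeaf T v ⊎ (degree T v ≡ 2 × ¬ parent v ≡ root × degree T (parent v) ≡ 2)
  candidate-shape (inj₁ leaf)       = inj₁ (leaf-shape leaf)
  candidate-shape (inj₂ (link , _)) = inj₂ (link-shape link)

  childless : ∀ {c v} → Leaf v → ¬ IsChild T c v
  childless (_ , none) c-child = contradiction (subst (1 ≤_) none (child-counted c-child)) λ ()

  -- No candidate is a child of another: a leaf has no children, a link has
  -- no leaf child, and a link's child has the next colour.
  candidate-not-child : ∀ {r u w} → Candidate r u → Candidate r w → ¬ IsChild T u w
  candidate-not-child _ (inj₁ leaf-w) u-child = childless leaf-w u-child
  candidate-not-child (inj₁ leaf-u) (inj₂ ((_ , _ , _ , _ , no-leaf-child , _) , _)) (_ , pu≡w) =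
    n>0⇒n≢0 (fibreSum-member leaf? parent leaf-u pu≡w) no-leaf-child
  candidate-not-child {u = u} {w} (inj₂ (_ , cu≡r)) (inj₂ (_ , cw≡r)) (u≢r , pu≡w) = next-≢ (colour w) (begin
      next (colour w)           ≡⟨ cong (next ∘ colour) pu≡w ⟨
      next (colour (parent u))  ≡⟨ colour-child u u≢r ⟨
      colour u                  ≡⟨ trans cu≡r (sym cw≡r) ⟩
      colour w                  ∎)
    where open ≡-Reasoning

  -- No candidate is a grandchild of another: a leaf has no children, a link
  -- has no leaf grandchild, and a link's grandchild has the colour after next.
  candidate-not-grandchild : ∀ {r u w c} → Candidate r u → Candidate r w → IsChild T c u → ¬ IsChild T w c
  candidate-not-grandchild (inj₁ leaf-u) _ c-child = ⊥-elim (childless leaf-u c-child)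
  candidate-not-grandchild (inj₂ ((_ , _ , _ , _ , _ , no-leaf-grandchild) , _)) (inj₁ leaf-w) (_ , pc≡u) (_ , pw≡c) =
    n>0⇒n≢0 (fibreSum-member leaf? (parent ∘ parent) leaf-w (trans (cong parent pw≡c) pc≡u)) no-leaf-grandchild
  candidate-not-grandchild {u = u} {w} {c} (inj₂ (_ , cu≡r)) (inj₂ (_ , cw≡r)) (c≢r , pc≡u) (w≢r , pw≡c) =
    next²-≢ (colour u) (begin
      next (next (colour u))             ≡⟨ cong (next ∘ next ∘ colour) pc≡u ⟨
      next (next (colour (parent c)))    ≡⟨ cong next (colour-child c c≢r) ⟨
      next (colour c)                    ≡⟨ cong (next ∘ colour) pw≡c ⟨
      next (colour (parent w))           ≡⟨ colour-child w w≢r ⟨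
      colour w                           ≡⟨ trans cw≡r (sym cu≡r) ⟩
      colour u                           ∎)
    where open ≡-Reasoning

lemma4 : (n : ℕ) → 2 ≤ n → (T : RootedTree n) →
    ∃[ S ] (Stable T S
      × ∣ S ∣ ≡ ⌈ n /6⌉
      × RootedTree.root T ∉ S
      × (∀ v → v ∈ S →
           IsLeaf T v
           ⊎ (degree T v ≡ 2
              × ¬ (RootedTree.parent T v ≡ RootedTree.root T)
              × degree T (RootedTree.parent T v) ≡ 2))
      × (∀ u w c → u ∈ S → w ∈ S → ¬ (u ≡ w) →
           IsChild T c u → ¬ IsChild T w c))
lemma4 n 2≤n T = S , stable , proj₂ (proj₂ trimmed) , root∉S , shape , spread
  where
  open Candidates T
  r : Fin 3
  r = proj₁ (enough-candidates 2≤n)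
  trimmed : ∃[ S ] (S ⊆ ⟦ candidate? r ⟧ × ∣ S ∣ ≡ ⌈ n /6⌉)
  trimmed = shrink ⟦ candidate? r ⟧ ⌈ n /6⌉
                   (subst (⌈ n /6⌉ ≤_) (sym (∣⟦⟧∣ (candidate? r))) (proj₂ (enough-candidates 2≤n)))
  S : Subset n
  S = proj₁ trimmed
  candidate : ∀ {v} → v ∈ S → Candidate r v
  candidate v∈S = ∈⟦⟧ (candidate? r) (proj₁ (proj₂ trimmed) v∈S)
  stable : Stable T S
  stable u w u∈S w∈S (inj₁ u-child) = candidate-not-child (candidate u∈S) (candidate w∈S) u-child
  stable u w u∈S w∈S (inj₂ w-child) = candidate-not-child (candidate w∈S) (candidate u∈S) w-child
  root∉S : RootedTree.root T ∉ S
  root∉S root∈S = candidate-nonRoot (candidate root∈S) refl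
  shape : ∀ v → v ∈ S → IsLeaf T v ⊎ (degree T v ≡ 2 × ¬ (RootedTree.parent T v ≡ RootedTree.root T)
                                      × degree T (RootedTree.parent T v) ≡ 2)
  shape v v∈S = candidate-shape (candidate v∈S)
  spread : ∀ u w c → u ∈ S → w ∈ S → ¬ (u ≡ w) → IsChild T c u → ¬ IsChild T w c
  spread u w c u∈S w∈S _ = candidate-not-grandchild (candidate u∈S) (candidate w∈S)
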